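{- Let $N = q^k n^2$ be an odd perfect number written in Eulerian form, i.e. $q$ is a prime with $q \equiv k \equiv 1 \pmod 4$, $n$ is a positive integer, and $\gcd(q,n)=1$. Then either $\dfrac{\sigma(q)}{n} < \sqrt{2}$ or $\dfrac{\sigma(n)}{q} < \sqrt{2}$.
   Context: $\sigma(x)$ denotes the sum of the positive divisors of the positive integer $x$. A positive integer $N$ is perfect if $\sigma(N) = 2N$. -}

module Defs where

open import Data.Nat using (ℕ; suc; _*_)
open import Data.Nat.Divisibility using (_∣?_)
open import Data.List using (List; filter; map; upTo)
open import Data.Nat.ListAction using (sum)
open import Relation.Binary.PropositionalEquality using (_≡_)

divisors : ℕ → List ℕ
divisors n = filter (λ d → d ∣? n) (map suc (upTo n))

σ : ℕ → ℕ
σ n = sum (divisors n)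

Perfect : ℕ → Set
Perfect N = σ N ≡ 2 * N

{-# OPTIONS --safe #-}
module Submission where

open import Defs
open import Data.Nat
  using (ℕ; zero; suc; _+_; _*_; _^_; _<_; _≤_; _%_; z≤n; z<s; s<s; NonZero; >-nonZero; ≢-nonZero⁻¹; nonTrivial⇒n>1; _<?_)
open import Data.Nat.Properties
open import Data.Nat.Divisibility
open import Data.Nat.GCD using (gcd)
open import Data.Nat.Coprimality using (Coprime; gcd≡1⇒coprime)
open import Data.Nat.Primality using (Prime; prime⇒irreducible; prime⇒nonTrivial)
open import Data.Nat.ListAction using (sum)
open import Data.Nat.ListAction.Properties using (sum-++)
open import Data.Nat.Solver using (module +-*-Solver)
open import Algebra.Properties.CommutativeSemigroup +-commutativeSemigroup
  using () renaming (x∙yz≈y∙xz to x+[y+z]≡y+[x+z])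
open import Algebra.Properties.CommutativeSemigroup *-commutativeSemigroup
  using () renaming (x∙yz≈y∙xz to x*[y*z]≡y*[x*z])
open import Data.List using (List; []; _∷_; _++_; map; upTo)
open import Data.List.Membership.Propositional using (_∈_)
open import Data.List.Membership.Propositional.Properties
open import Data.List.Relation.Binary.Subset.Propositional using (_⊆_)
open import Data.List.Relation.Binary.Disjoint.Propositional using (Disjoint)
open import Data.List.Relation.Unary.Any using (here; there)
open import Data.List.Relation.Unary.All as All using (All)
import Data.List.Relation.Unary.All.Properties as All
open import Data.List.Relation.Unary.Unique.Propositional using (Unique; _∷_)
import Data.List.Relation.Unary.Unique.Propositional.Properties as Unique
open import Data.Product using (_,_; proj₁; proj₂)
open import Data.Sum using (_⊎_; inj₁; inj₂)
open import Relation.Nullary using (yes; no; contradiction)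
open import Relation.Binary.PropositionalEquality

-- With N = q^k n² and b = q^(k-1) n, where n > 1 (n = 1 is immediate as σ(1) = 1),
-- the numbers 1, q·b·e and b·e (e ∣ n) are distinct divisors of N = q·b·n,
-- because b > 1 and q ∤ e for every e ∣ n. Hence
-- 2N = σ(N) > (q + 1) b σ(n), i.e. σ(q) σ(n) = (q + 1) σ(n) < 2 q n. If both
-- σ(q)² ≥ 2n² and σ(n)² ≥ 2q², multiplying would give (σ(q) σ(n))² ≥ (2qn)².

sum-map-*ˡ : ∀ c (xs : List ℕ) → sum (map (c *_) xs) ≡ c * sum xs
sum-map-*ˡ c [] = sym (*-zeroʳ c)
sum-map-*ˡ c (x ∷ xs) = trans (cong (c * x +_) (sum-map-*ˡ c xs)) (sym (*-distribˡ-+ c x (sum xs)))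

sum-mono-⊆ : ∀ {xs ys : List ℕ} → Unique xs → xs ⊆ ys → sum xs ≤ sum ys
sum-mono-⊆ {[]} _ _ = z≤n
sum-mono-⊆ {x ∷ xs} (x∉xs ∷ xs-unique) xs⊆ys with ∈-∃++ (xs⊆ys (here refl))
... | as , bs , refl = begin
  x + sum xs             ≤⟨ +-monoʳ-≤ x (sum-mono-⊆ xs-unique xs⊆as++bs) ⟩
  x + sum (as ++ bs)     ≡⟨ cong (x +_) (sum-++ as bs) ⟩
  x + (sum as + sum bs)  ≡⟨ x+[y+z]≡y+[x+z] x (sum as) (sum bs) ⟩
  sum as + (x + sum bs)  ≡⟨ sum-++ as (x ∷ bs) ⟨
  sum (as ++ x ∷ bs)     ∎
  where
  open ≤-Reasoning
  xs⊆as++bs : xs ⊆ as ++ bs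
  xs⊆as++bs {y} y∈xs with ∈-++⁻ as (xs⊆ys (there y∈xs))
  ... | inj₁ y∈as = ∈-++⁺ˡ y∈as
  ... | inj₂ (here refl) = contradiction refl (All.lookup x∉xs y∈xs)
  ... | inj₂ (there y∈bs) = ∈-++⁺ʳ as y∈bs

∈-divisors⁺ : ∀ {d m} .{{_ : NonZero m}} → d ∣ m → d ∈ divisors m
∈-divisors⁺ {zero} {m} 0∣m = contradiction (0∣⇒≡0 0∣m) (≢-nonZero⁻¹ m)
∈-divisors⁺ {suc d} {m} d∣m = ∈-filter⁺ (_∣? m) (∈-map⁺ suc (∈-upTo⁺ (∣⇒≤ d∣m))) d∣m

∈-divisors⁻ : ∀ {d m} → d ∈ divisors m → d ∣ m
∈-divisors⁻ {m = m} d∈ = proj₂ (∈-filter⁻ (_∣? m) {xs = map suc (upTo m)} d∈)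

∈-divisors⇒>0 : ∀ {d m} → d ∈ divisors m → 0 < d
∈-divisors⇒>0 {m = m} d∈ with ∈-map⁻ suc (proj₁ (∈-filter⁻ (_∣? m) {xs = map suc (upTo m)} d∈))
... | _ , _ , refl = z<s

divisors-unique : ∀ m → Unique (divisors m)
divisors-unique m = Unique.filter⁺ (_∣? m) (Unique.map⁺ suc-injective (Unique.upTo⁺ m))

prime>1 : ∀ {p} → Prime p → 1 < p
prime>1 {p} p-prime = nonTrivial⇒n>1 p {{prime⇒nonTrivial p-prime}}

σ[p]≤1+p : ∀ {p} → Prime p → σ p ≤ 1 + p
σ[p]≤1+p {p} p-prime = subst (σ p ≤_) (cong (1 +_) (+-identityʳ p))
  (sum-mono-⊆ (divisors-unique p) divisors[p]⊆[1,p])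
  where
  divisors[p]⊆[1,p] : divisors p ⊆ 1 ∷ p ∷ []
  divisors[p]⊆[1,p] d∈ with prime⇒irreducible p-prime (∈-divisors⁻ d∈)
  ... | inj₁ refl = here refl
  ... | inj₂ refl = there (here refl)

map-*-divisors⊆ : ∀ {c n m} .{{_ : NonZero m}} → c * n ∣ m → map (c *_) (divisors n) ⊆ divisors m
map-*-divisors⊆ {c} cn∣m x∈ with ∈-map⁻ (c *_) x∈
... | e , e∈ , refl = ∈-divisors⁺ (∣-trans (*-monoʳ-∣ c (∈-divisors⁻ e∈)) cn∣m)

map-*-divisors-unique : ∀ c .{{_ : NonZero c}} n → Unique (map (c *_) (divisors n))
map-*-divisors-unique c n = Unique.map⁺ (*-cancelˡ-≡ _ _ c) (divisors-unique n)

map-*-divisors>1 : ∀ {c} n → 1 < c → All (1 <_) (map (c *_) (divisors n))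
map-*-divisors>1 {c} n 1<c = All.map⁺ (All.tabulate 1<c*e)
  where
  1<c*e : ∀ {e} → e ∈ divisors n → 1 < c * e
  1<c*e e∈ = <-≤-trans 1<c (m≤m*n c _ {{>-nonZero (∈-divisors⇒>0 {m = n} e∈)}})

map-*-divisors-disjoint : ∀ {p b n} → 1 < p → Coprime p n → .{{_ : NonZero b}} →
                          Disjoint (map (p * b *_) (divisors n)) (map (b *_) (divisors n))
map-*-divisors-disjoint {p} {b} 1<p p⊥n (x∈₁ , x∈₂) with ∈-map⁻ (p * b *_) x∈₁ | ∈-map⁻ (b *_) x∈₂
... | e , _ , refl | e′ , e′∈ , pbe≡be′ =
  >⇒≢ 1<p (p⊥n (∣-refl , ∣-trans (subst (p ∣_) pe≡e′ (m∣m*n e)) (∈-divisors⁻ e′∈)))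
  where
  pe≡e′ : p * e ≡ e′
  pe≡e′ = *-cancelˡ-≡ (p * e) e′ b (begin
    b * (p * e)  ≡⟨ *-assoc b p e ⟨
    b * p * e    ≡⟨ cong (_* e) (*-comm b p) ⟩
    p * b * e    ≡⟨ pbe≡be′ ⟩
    b * e′       ∎)
    where open ≡-Reasoning

1+[1+p]*b*σ[n]≤σ[p*b*n] : ∀ {p b n} → 1 < p → 1 < b → .{{_ : NonZero n}} → Coprime p n →
                          1 + (1 + p) * (b * σ n) ≤ σ (p * b * n)
1+[1+p]*b*σ[n]≤σ[p*b*n] {p} {b} {n} 1<p 1<b p⊥n = begin
  1 + (1 + p) * (b * σ n)  ≡⟨ cong (1 +_) sum-pbDn++bDn ⟨
  sum L                    ≤⟨ sum-mono-⊆ L-unique L⊆divisors ⟩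
  σ (p * b * n)            ∎
  where
  open ≤-Reasoning
  instance
    p≢0 : NonZero p
    p≢0 = >-nonZero (<-trans z<s 1<p)
    b≢0 : NonZero b
    b≢0 = >-nonZero (<-trans z<s 1<b)
    pb≢0 : NonZero (p * b)
    pb≢0 = m*n≢0 p b
    pbn≢0 : NonZero (p * b * n)
    pbn≢0 = m*n≢0 (p * b) n

  pbDn bDn L : List ℕ
  pbDn = map (p * b *_) (divisors n)
  bDn = map (b *_) (divisors n)
  L = 1 ∷ pbDn ++ bDn

  sum-pbDn++bDn : sum (pbDn ++ bDn) ≡ (1 + p) * (b * σ n)
  sum-pbDn++bDn = begin-equality
    sum (pbDn ++ bDn)        ≡⟨ sum-++ pbDn bDn ⟩
    sum pbDn + sum bDn       ≡⟨ cong₂ _+_ (sum-map-*ˡ (p * b) (divisors n)) (sum-map-*ˡ b (divisors n)) ⟩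
    p * b * σ n + b * σ n    ≡⟨ x*y*z+y*z≡[1+x]*[y*z] p b (σ n) ⟩
    (1 + p) * (b * σ n)      ∎
    where
    open +-*-Solver
    x*y*z+y*z≡[1+x]*[y*z] : ∀ x y z → x * y * z + y * z ≡ (1 + x) * (y * z)
    x*y*z+y*z≡[1+x]*[y*z] = solve 3 (λ x y z → x :* y :* z :+ y :* z := (con 1 :+ x) :* (y :* z)) refl

  L-unique : Unique L
  L-unique = All.map <⇒≢ (All.++⁺ (map-*-divisors>1 n 1<p*b) (map-*-divisors>1 n 1<b))
           ∷ Unique.++⁺ (map-*-divisors-unique (p * b) n) (map-*-divisors-unique b n)
                        (map-*-divisors-disjoint 1<p p⊥n)
    where
    1<p*b : 1 < p * b
    1<p*b = <-≤-trans 1<b (m≤n*m b p)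

  L⊆divisors : L ⊆ divisors (p * b * n)
  L⊆divisors (here refl) = ∈-divisors⁺ (1∣ (p * b * n))
  L⊆divisors (there x∈) with ∈-++⁻ pbDn x∈
  ... | inj₁ x∈pbDn = map-*-divisors⊆ {p * b} {n} ∣-refl x∈pbDn
  ... | inj₂ x∈bDn = map-*-divisors⊆ {b} {n} (divides p (*-assoc p b n)) x∈bDn

perfect⇒[1+q]*σ[n]<2*q*n : ∀ {q k n} → 1 < q → 1 < n → Coprime q n →
                           Perfect (q ^ suc k * n ^ 2) → (1 + q) * σ n < 2 * q * n
perfect⇒[1+q]*σ[n]<2*q*n {q} {k} {n} 1<q 1<n q⊥n perfect = *-cancelˡ-< b _ _ (begin-strict
  b * ((1 + q) * σ n)      ≡⟨ x*[y*z]≡y*[x*z] b (1 + q) (σ n) ⟩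
  (1 + q) * (b * σ n)      <⟨ n<1+n _ ⟩
  1 + (1 + q) * (b * σ n)  ≤⟨ 1+[1+p]*b*σ[n]≤σ[p*b*n] 1<q 1<b q⊥n ⟩
  σ (q * b * n)            ≡⟨ cong σ (x*[y*z]*z≡x*y*z² q (q ^ k) n) ⟩
  σ (q ^ suc k * n ^ 2)    ≡⟨ perfect ⟩
  2 * (q ^ suc k * n ^ 2)  ≡⟨ 2*[x*y*z²]≡y*z*[2*x*z] q (q ^ k) n ⟩
  b * (2 * q * n)          ∎)
  where
  open ≤-Reasoning
  instance
    q≢0 : NonZero q
    q≢0 = >-nonZero (<-trans z<s 1<q)
    n≢0 : NonZero n
    n≢0 = >-nonZero (<-trans z<s 1<n)
    qᵏ≢0 : NonZero (q ^ k)
    qᵏ≢0 = m^n≢0 q k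

  b : ℕ
  b = q ^ k * n

  1<b : 1 < b
  1<b = <-≤-trans 1<n (m≤n*m n (q ^ k))

  open +-*-Solver
  x*[y*z]*z≡x*y*z² : ∀ x y z → x * (y * z) * z ≡ x * y * z ^ 2
  x*[y*z]*z≡x*y*z² = solve 3 (λ x y z → x :* (y :* z) :* z := x :* y :* z :^ 2) refl
  2*[x*y*z²]≡y*z*[2*x*z] : ∀ x y z → 2 * (x * y * z ^ 2) ≡ y * z * (2 * x * z)
  2*[x*y*z²]≡y*z*[2*x*z] = solve 3 (λ x y z → con 2 :* (x :* y :* z :^ 2) := y :* z :* (con 2 :* x :* z)) refl

x*y<2*q*n⇒x²<2*n²⊎y²<2*q² : ∀ x y q n → x * y < 2 * q * n → x ^ 2 < 2 * n ^ 2 ⊎ y ^ 2 < 2 * q ^ 2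
x*y<2*q*n⇒x²<2*n²⊎y²<2*q² x y q n xy<2qn with x ^ 2 <? 2 * n ^ 2 | y ^ 2 <? 2 * q ^ 2
... | yes x²<2n² | _ = inj₁ x²<2n²
... | no _ | yes y²<2q² = inj₂ y²<2q²
... | no x²≮2n² | no y²≮2q² = contradiction (begin-strict
  (2 * q * n) * (2 * q * n)   ≡⟨ [2*a*b]²≡2*b²*[2*a²] q n ⟩
  (2 * n ^ 2) * (2 * q ^ 2)   ≤⟨ *-mono-≤ (≮⇒≥ x²≮2n²) (≮⇒≥ y²≮2q²) ⟩
  x ^ 2 * y ^ 2               ≡⟨ a²*b²≡[a*b]² x y ⟩
  (x * y) * (x * y)           <⟨ *-mono-< xy<2qn xy<2qn ⟩
  (2 * q * n) * (2 * q * n)   ∎) (<-irrefl refl)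
  where
  open ≤-Reasoning
  open +-*-Solver
  [2*a*b]²≡2*b²*[2*a²] : ∀ a b → (2 * a * b) * (2 * a * b) ≡ (2 * b ^ 2) * (2 * a ^ 2)
  [2*a*b]²≡2*b²*[2*a²] = solve 2 (λ a b → (con 2 :* a :* b) :* (con 2 :* a :* b) := (con 2 :* b :^ 2) :* (con 2 :* a :^ 2)) refl
  a²*b²≡[a*b]² : ∀ a b → a ^ 2 * b ^ 2 ≡ (a * b) * (a * b)
  a²*b²≡[a*b]² = solve 2 (λ a b → a :^ 2 :* b :^ 2 := (a :* b) :* (a :* b)) refl

mainTheorem4 : (q k n : ℕ) → Prime q → q % 4 ≡ 1 → k % 4 ≡ 1 → 0 < n → gcd q n ≡ 1
    → (q ^ k * n ^ 2) % 2 ≡ 1 → Perfect (q ^ k * n ^ 2)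
    → (σ q ^ 2 < 2 * n ^ 2) ⊎ (σ n ^ 2 < 2 * q ^ 2)
mainTheorem4 q zero n _ _ () _ _ _ _
mainTheorem4 q (suc k) zero _ _ _ () _ _ _
mainTheorem4 q (suc k) 1 q-prime _ _ _ _ _ _ =
  inj₂ (*-monoʳ-≤ 2 (m^n>0 q {{>-nonZero (<-trans z<s (prime>1 q-prime))}} 2))
mainTheorem4 q (suc k) n@(suc (suc _)) q-prime _ _ _ gcd[q,n]≡1 _ perfect =
  x*y<2*q*n⇒x²<2*n²⊎y²<2*q² (σ q) (σ n) q n (begin-strict
    σ q * σ n        ≤⟨ *-monoˡ-≤ (σ n) (σ[p]≤1+p q-prime) ⟩
    (1 + q) * σ n    <⟨ perfect⇒[1+q]*σ[n]<2*q*n {k = k} (prime>1 q-prime) (s<s z<s)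
                                                   (gcd≡1⇒coprime gcd[q,n]≡1) perfect ⟩
    2 * q * n        ∎)
  where open ≤-Reasoning
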